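{- For all integers $d \geq 1$ and $h \geq 1$, the double-tree of degree $d$ and height $h$ is $d$-connected.
   Context: The double-tree of degree $d$ and height $h$ is the following graph. Take two disjoint complete rooted $d$-ary trees of height $h$ (every inner vertex has exactly $d$ children and all leaves are at depth $h$), called the upper and the lower tree, each drawn in the plane with children ordered left to right. Let $l = d^{h-1}$ be the number of parents of leaves in each tree. Name the leaves of the upper tree from left to right $u_1^1,\ldots,u_d^1,u_1^2,\ldots,u_d^2,\ldots,u_1^l,\ldots,u_d^l$ (so $u_1^j,\ldots,u_d^j$ are the children of the $j$-th parent of leaves), and likewise the leaves of the lower tree $v_1^1,\ldots,v_d^l$. Besides the tree edges, add $E_1 = \{u_i^j u_{i+1}^j, \ v_i^j v_{i+1}^j : 1\le i\le d-1,\ 1\le j\le l\} \cup \{u_d^j u_1^{j+1},\ v_d^j v_1^{j+1} : 1\le j\le l-1\}$ and $E_2 = \{u_n^j v_m^j : 1\le j\le l,\ n\le m\} \cup \{u_n^j v_m^{j+1} : 1\le j\le l-1,\ m<n\} \cup \{u_n^l v_m^1 : m<n\}$, where $1\le n,m\le d$. -}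

module Defs where

open import Data.Nat using (ℕ; zero; suc; _+_; _*_; _∸_; _^_; _≤_; _<_)
open import Data.Fin using (Fin; toℕ)
open import Data.Bool using (Bool; true; false)
open import Data.List using (List; []; _∷_; _∷ʳ_; length; foldl)
open import Data.List.Membership.Propositional using (_∉_)
open import Data.List.Relation.Unary.Unique.Propositional using (Unique)
open import Data.Product using (Σ; _×_)
open import Data.Sum using (_⊎_)
open import Relation.Binary.PropositionalEquality using (_≡_)

data WalkAvoiding {V : Set} (E : V → V → Set) (X : List V) : V → V → Set where
  here : ∀ {x} → WalkAvoiding E X x x
  step : ∀ {x y z} → E x y → y ∉ X → WalkAvoiding E X y z → WalkAvoiding E X x z

ConnectedAvoiding : {V : Set} → (V → V → Set) → List V → Set
ConnectedAvoiding {V} E X = ∀ (x y : V) → x ∉ X → y ∉ X → WalkAvoiding E X x y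

-- k-connected (Diestel): |G| > k and G - X is connected for every set X of
-- fewer than k vertices.  (A finite set of size < k is given by a list of
-- length < k; "|G| > k" by k+1 pairwise distinct vertices.)
KConnected : {V : Set} → (V → V → Set) → ℕ → Set
KConnected {V} E k =
  Σ (List V) (λ vs → Unique vs × k < length vs)
  × (∀ (X : List V) → length X < k → ConnectedAvoiding E X)

-- A vertex: side (true = upper tree, false = lower tree) and the path from
-- the root (list of child indices, read top-down), of length ≤ h.
record Vtx (d h : ℕ) : Set where
  constructor vtx
  field
    upper : Bool
    path  : List (Fin d)
    depth≤ : length path ≤ h

-- Left-to-right position (0-based) of a node at a fixed depth:
-- the base-d value of its path.
pos : ∀ {d} → List (Fin d) → ℕ
pos {d} = foldl (λ a c → a * d + toℕ c) 0

-- A leaf is written q ∷ʳ c where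
-- suc (length q) ≡ h; then (0-based) j = pos q (q is the (j+1)-th parent of
-- leaves) and i = toℕ c, i.e. the leaf is u_{i+1}^{j+1} (or v_{i+1}^{j+1}).
data Adj {d h : ℕ} : Vtx d h → Vtx d h → Set where
  tree : ∀ {s p c le le'} → Adj (vtx s p le) (vtx s (p ∷ʳ c) le')
  -- E₁: u_i^j u_{i+1}^j  and  v_i^j v_{i+1}^j
  e1-in : ∀ {s q c c' le le'} → suc (length q) ≡ h → suc (toℕ c) ≡ toℕ c' →
          Adj (vtx s (q ∷ʳ c) le) (vtx s (q ∷ʳ c') le')
  -- E₁: u_d^j u_1^{j+1}  and  v_d^j v_1^{j+1}
  e1-cross : ∀ {s q q' c c' le le'} → suc (length q) ≡ h → length q' ≡ length q →
             suc (pos q) ≡ pos q' → suc (toℕ c) ≡ d → toℕ c' ≡ 0 →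
             Adj (vtx s (q ∷ʳ c) le) (vtx s (q' ∷ʳ c') le')
  -- E₂: u_n^j v_m^j  with n ≤ m
  e2-same : ∀ {q c c' le le'} → suc (length q) ≡ h → toℕ c ≤ toℕ c' →
            Adj (vtx true (q ∷ʳ c) le) (vtx false (q ∷ʳ c') le')
  -- E₂: u_n^j v_m^{j+1}  with m < n
  e2-next : ∀ {q q' c c' le le'} → suc (length q) ≡ h → length q' ≡ length q →
            suc (pos q) ≡ pos q' → toℕ c' < toℕ c →
            Adj (vtx true (q ∷ʳ c) le) (vtx false (q' ∷ʳ c') le')
  -- E₂: u_n^l v_m^1  with m < n, where l = d^(h-1)
  e2-wrap : ∀ {q q' c c' le le'} → suc (length q) ≡ h → length q' ≡ length q →
            suc (pos q) ≡ d ^ (h ∸ 1) → pos q' ≡ 0 → toℕ c' < toℕ c →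
            Adj (vtx true (q ∷ʳ c) le) (vtx false (q' ∷ʳ c') le')

DTEdge : (d h : ℕ) → Vtx d h → Vtx d h → Set
DTEdge d h x y = Adj x y ⊎ Adj y x

module Submission where

-- Number the leaves of each tree from left to right by
-- positions 0, …, N-1 (N = d^h); a leaf's path is the base-d numeral of
-- its position.  In these terms the edges E₂ say exactly that the upper
-- leaf at position t is adjacent to the d lower leaves t, t+1, …, t+d-1
-- (positions taken cyclically mod N).  Fix a set X of fewer than d
-- vertices.  Everything rests on one pigeonhole principle: for any labelling
-- of the vertices by numbers, some label below d is carried by no vertex of
-- X.  With suitable labellings we show
--   (1) every free vertex descends inside its tree to a free leaf;
--   (2) every free upper leaf has a free lower neighbour;
--   (3) two free lower leaves a and a+k are joined outside X: by induction
--       on k, splitting at a free leaf in between; if there is none, the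
--       k-1 leaves in between lie in X, and then either a free upper leaf
--       is adjacent to both ends, or X misses the whole interior of the
--       lower tree and we pass through its root.
-- Hence G - X is connected.  Finally the upper root and its d children are
-- d+1 distinct vertices.

open import Data.Nat
open import Data.Nat.Properties
open import Data.Nat.DivMod
open import Data.Nat.Divisibility using (n∣m*n)
open import Data.Nat.Induction using (<-wellFounded)
open import Data.Nat.Tactic.RingSolver using (solve-∀)
open import Induction.WellFounded using (Acc; acc)
open import Data.Bool using (Bool; true; false)
import Data.Bool as Bool
open import Data.Fin using (Fin; toℕ; fromℕ<) renaming (zero to fzero)
import Data.Fin as Fin
open import Data.Fin.Properties using (toℕ-fromℕ<; toℕ<n; toℕ-injective; all?; ¬∀⟶∃¬)
open import Data.List using (List; []; _∷_; _∷ʳ_; _++_; length; map; filter; replicate; allFin; initLast; _∷ʳ′_)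
open import Data.List.Properties using (length-++; length-map; length-replicate; length-tabulate; ++-assoc; ++-identityʳ; ∷-injective; ≡-dec; filter-notAll; foldl-∷ʳ)
open import Data.List.Membership.Propositional using (_∈_; _∉_)
open import Data.List.Membership.Propositional.Properties using (∈-map⁺; ∈-filter⁺)
import Data.List.Membership.DecPropositional as DecMembership
open import Data.List.Relation.Unary.Any as Any using ()
open import Data.List.Relation.Unary.All using (All; []; _∷_)
open import Data.List.Relation.Unary.AllPairs using (_∷_)
open import Data.List.Relation.Unary.Unique.Propositional using (Unique)
import Data.List.Relation.Unary.Unique.Propositional.Properties as Unique
open import Data.Product using (_×_; _,_; proj₁; proj₂; ∃-syntax)
open import Data.Sum using (inj₁; inj₂)
open import Data.Empty using (⊥-elim)
open import Function using (_∘_)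
open import Relation.Nullary using (¬_; yes; no; ¬?)
open import Relation.Binary.Definitions using (DecidableEquality)
open import Relation.Binary.PropositionalEquality
open import Defs

module Walks {V : Set} {E : V → V → Set} {X : List V} where

  Walk : V → V → Set
  Walk = WalkAvoiding E X

  _++ʷ_ : ∀ {x y z} → Walk x y → Walk y z → Walk x z
  here ++ʷ w′ = w′
  step e y∉X w ++ʷ w′ = step e y∉X (w ++ʷ w′)

  edge-walk : ∀ {x y} → E x y → y ∉ X → Walk x y
  edge-walk e y∉X = step e y∉X here

  reverse : (∀ {a b} → E a b → E b a) → ∀ {x y} → x ∉ X → Walk x y → Walk y x
  reverse sym-E x∉X here = here
  reverse sym-E x∉X (step e y∉X w) = reverse sym-E y∉X w ++ʷ edge-walk (sym-E e) x∉X

  end-free : ∀ {x y} → x ∉ X → Walk x y → y ∉ X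
  end-free x∉X here = x∉X
  end-free x∉X (step e y∉X w) = end-free y∉X w

missing : ∀ d (L : List ℕ) → length L < d → ∃[ i ] i < d × i ∉ L
missing (suc d) L |L|<d+1 with d DecN.∈? L
  where module DecN = DecMembership _≟_
... | no d∉L = d , ≤-refl , d∉L
... | yes d∈L with missing d (filter (¬? ∘ (_≟ d)) L) shorter
  where
  shorter : length (filter (¬? ∘ (_≟ d)) L) < d
  shorter = <-≤-trans (filter-notAll (¬? ∘ (_≟ d)) L (Any.map (λ d≡x x≢d → x≢d (sym d≡x)) d∈L))
                      (≤-pred |L|<d+1)
... | i , i<d , i∉L′ = i , m<n⇒m<1+n i<d , λ i∈L → i∉L′ (∈-filter⁺ (¬? ∘ (_≟ d)) i∈L (<⇒≢ i<d))

free-label : ∀ {V : Set} d (σ : V → ℕ) (X : List V) → length X < d →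
             ∃[ i ] i < d × (∀ z → σ z ≡ i → z ∉ X)
free-label d σ X |X|<d with missing d (map σ X) (subst (_< d) (sym (length-map σ X)) |X|<d)
... | i , i<d , i∉σX = i , i<d , λ z σz≡i z∈X → i∉σX (subst (_∈ map σ X) σz≡i (∈-map⁺ σ z∈X))

length-∷ʳ : ∀ {A : Set} (xs : List A) x → length (xs ∷ʳ x) ≡ suc (length xs)
length-∷ʳ xs x = trans (length-++ xs) (+-comm (length xs) 1)

module Numerals (d : ℕ) .{{_ : NonZero d}} where

  digits : ℕ → ℕ → List (Fin d)
  digits zero t = []
  digits (suc k) t = digits k (t / d) ∷ʳ fromℕ< (m%n<n t d)

  length-digits : ∀ k t → length (digits k t) ≡ k
  length-digits zero t = refl
  length-digits (suc k) t = trans (length-∷ʳ (digits k (t / d)) _) (cong suc (length-digits k (t / d)))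

  pos-∷ʳ : ∀ (q : List (Fin d)) c → pos (q ∷ʳ c) ≡ toℕ c + pos q * d
  pos-∷ʳ q c = trans (foldl-∷ʳ _ 0 c q) (+-comm (pos q * d) (toℕ c))

  block-div : ∀ r Q → r < d → (r + Q * d) / d ≡ Q
  block-div r Q r<d = begin
    (r + Q * d) / d     ≡⟨ +-distrib-/-∣ʳ r (n∣m*n Q) ⟩
    r / d + Q * d / d   ≡⟨ cong₂ _+_ (m<n⇒m/n≡0 r<d) (m*n/n≡m Q d) ⟩
    Q                   ∎
    where open ≡-Reasoning

  block-mod : ∀ r Q → r < d → (r + Q * d) % d ≡ r
  block-mod r Q r<d = trans ([m+kn]%n≡m%n r Q d) (m<n⇒m%n≡m r<d)

  pos-digits : ∀ k t → t < d ^ k → pos (digits k t) ≡ t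
  pos-digits zero zero _ = refl
  pos-digits zero (suc t) (s≤s ())
  pos-digits (suc k) t t<d^k+1 = begin
    pos (digits k (t / d) ∷ʳ fromℕ< (m%n<n t d))   ≡⟨ pos-∷ʳ (digits k (t / d)) _ ⟩
    toℕ (fromℕ< (m%n<n t d)) + pos (digits k (t / d)) * d
      ≡⟨ cong₂ (λ r Q → r + Q * d) (toℕ-fromℕ< _) (pos-digits k (t / d) t/d<d^k) ⟩
    t % d + t / d * d                              ≡⟨ m≡m%n+[m/n]*n t d ⟨
    t                                              ∎
    where
    open ≡-Reasoning
    t/d<d^k : t / d < d ^ k
    t/d<d^k = m<n*o⇒m/o<n (subst (t <_) (*-comm d (d ^ k)) t<d^k+1)

  pos< : ∀ k (p : List (Fin d)) → length p ≡ k → pos p < d ^ k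
  pos< k p |p|≡k with initLast p
  pos< zero .[] _ | [] = s≤s z≤n
  pos< zero .(q ∷ʳ c) |p|≡0 | q ∷ʳ′ c with () ← trans (sym (length-∷ʳ q c)) |p|≡0
  pos< (suc k) .(q ∷ʳ c) |p|≡k | q ∷ʳ′ c = begin-strict
    pos (q ∷ʳ c)          ≡⟨ pos-∷ʳ q c ⟩
    toℕ c + pos q * d     <⟨ +-monoˡ-< (pos q * d) (toℕ<n c) ⟩
    suc (pos q) * d       ≤⟨ *-monoˡ-≤ d (pos< k q (suc-injective (trans (sym (length-∷ʳ q c)) |p|≡k))) ⟩
    d ^ k * d             ≡⟨ *-comm (d ^ k) d ⟩
    d ^ suc k             ∎
    where open ≤-Reasoning

  digits-pos : ∀ k (p : List (Fin d)) → length p ≡ k → digits k (pos p) ≡ p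
  digits-pos k p |p|≡k with initLast p
  digits-pos zero .[] _ | [] = refl
  digits-pos zero .(q ∷ʳ c) |p|≡0 | q ∷ʳ′ c with () ← trans (sym (length-∷ʳ q c)) |p|≡0
  digits-pos (suc k) .(q ∷ʳ c) |p|≡k | q ∷ʳ′ c = cong₂ _∷ʳ_ init-digits last-digit
    where
    value : pos (q ∷ʳ c) ≡ toℕ c + pos q * d
    value = pos-∷ʳ q c
    init-digits : digits k (pos (q ∷ʳ c) / d) ≡ q
    init-digits = trans (cong (λ t → digits k (t / d)) value)
                   (trans (cong (digits k) (block-div (toℕ c) (pos q) (toℕ<n c)))
                          (digits-pos k q (suc-injective (trans (sym (length-∷ʳ q c)) |p|≡k))))
    last-digit : fromℕ< (m%n<n (pos (q ∷ʳ c)) d) ≡ c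
    last-digit = toℕ-injective (trans (toℕ-fromℕ< _)
                   (trans (cong (_% d) value) (block-mod (toℕ c) (pos q) (toℕ<n c))))

module DoubleTree (d′ h′ : ℕ) where

  d h : ℕ
  d = suc d′
  h = suc h′

  open Numerals d

  -- l = d^(h-1) parents of leaves and N = d^h leaves in each tree.
  l N : ℕ
  l = d ^ h′
  N = d ^ h

  instance
    N-nonZero : NonZero N
    N-nonZero = m^n≢0 d h

  N≡l*d : N ≡ l * d
  N≡l*d = *-comm d l

  d≤N : d ≤ N
  d≤N = subst (_≤ N) (*-identityʳ d) (*-monoʳ-≤ d (m^n>0 d h′))

  V : Set
  V = Vtx d h

  _~_ : V → V → Set
  _~_ = DTEdge d h

  ~-sym : ∀ {x y} → x ~ y → y ~ x
  ~-sym (inj₁ a) = inj₂ a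
  ~-sym (inj₂ a) = inj₁ a

  vtx-cong : ∀ {s p p′ le le′} → p ≡ p′ → vtx {d} {h} s p le ≡ vtx s p′ le′
  vtx-cong {le = le} {le′} refl = cong (vtx _ _) (≤-irrelevant le le′)

  _≟ᵛ_ : DecidableEquality V
  vtx s p _ ≟ᵛ vtx s′ p′ _ with s Bool.≟ s′ | ≡-dec Fin._≟_ p p′
  ... | yes refl | yes p≡p′ = yes (vtx-cong p≡p′)
  ... | no s≢s′  | _        = no (s≢s′ ∘ cong Vtx.upper)
  ... | yes _    | no p≢p′  = no (p≢p′ ∘ cong Vtx.path)

  leafAt : Bool → ℕ → V
  leafAt s T = vtx s (digits h T) (≤-reflexive (length-digits h T))

  leaf : Bool → ℕ → V
  leaf s t = leafAt s (t % N)

  leaf-mod : ∀ s {t t′} → t % N ≡ t′ % N → leaf s t ≡ leaf s t′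
  leaf-mod s eq = cong (leafAt s) eq

  leaf-pos : ∀ s p le → length p ≡ h → vtx s p le ≡ leaf s (pos p)
  leaf-pos s p le |p|≡h =
    vtx-cong (sym (trans (cong (digits h) (m<n⇒m%n≡m (pos< h p |p|≡h))) (digits-pos h p |p|≡h)))

  pos-leaf : ∀ s t → pos (Vtx.path (leaf s t)) ≡ t % N
  pos-leaf s t = pos-digits h (t % N) (m%n<n t N)

  -- Leaf position T = (T % d) + (T / d)·d: the leaf is child T % d of the
  -- (T / d)-th parent of leaves.
  parent< : ∀ {T} → T < N → T / d < l
  parent< {T} T<N = m<n*o⇒m/o<n (subst (T <_) N≡l*d T<N)

  position< : ∀ {r Q} → r < d → Q < l → r + Q * d < N
  position< {r} {Q} r<d Q<l = begin-strict
    r + Q * d   <⟨ +-monoˡ-< (Q * d) r<d ⟩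
    suc Q * d   ≤⟨ *-monoˡ-≤ d Q<l ⟩
    l * d       ≡⟨ N≡l*d ⟨
    N           ∎
    where open ≤-Reasoning

  -- How a lower position S sits relative to an upper position T in the three
  -- families of E₂ edges: same parent, next parent, or last/first parent.
  data E₂Pattern (T S : ℕ) : Set where
    same-parent : S / d ≡ T / d → T % d ≤ S % d → E₂Pattern T S
    next-parent : S / d ≡ suc (T / d) → S % d < T % d → E₂Pattern T S
    wrap-around : suc (T / d) ≡ l → S / d ≡ 0 → S % d < T % d → E₂Pattern T S

  digit-value : ∀ T → toℕ (fromℕ< (m%n<n T d)) ≡ T % d
  digit-value T = toℕ-fromℕ< (m%n<n T d)

  leaf-depth : ∀ T → suc (length (digits h′ (T / d))) ≡ h
  leaf-depth T = cong suc (length-digits h′ (T / d))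

  parents-same-depth : ∀ T S → length (digits h′ (S / d)) ≡ length (digits h′ (T / d))
  parents-same-depth T S = trans (length-digits h′ (S / d)) (sym (length-digits h′ (T / d)))

  parent-pos : ∀ {T} → T < N → pos (digits h′ (T / d)) ≡ T / d
  parent-pos {T} T<N = pos-digits h′ (T / d) (parent< T<N)

  e2-same′ : ∀ {q q′ : List (Fin d)} {c c′ le le′} → q ≡ q′ → suc (length q) ≡ h → toℕ c ≤ toℕ c′ →
             Adj (vtx true (q ∷ʳ c) le) (vtx false (q′ ∷ʳ c′) le′)
  e2-same′ refl = e2-same

  E₂-adjacent : ∀ {T S} → T < N → S < N → E₂Pattern T S → Adj (leafAt true T) (leafAt false S)
  E₂-adjacent {T} {S} T<N S<N (same-parent S/d≡ T%d≤) =
    e2-same′ (sym (cong (digits h′) S/d≡)) (leaf-depth T) (subst₂ _≤_ (sym (digit-value T)) (sym (digit-value S)) T%d≤)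
  E₂-adjacent {T} {S} T<N S<N (next-parent S/d≡ S%d<) =
    e2-next (leaf-depth T) (parents-same-depth T S)
      (trans (cong suc (parent-pos T<N)) (sym (trans (parent-pos S<N) S/d≡)))
      (subst₂ _<_ (sym (digit-value S)) (sym (digit-value T)) S%d<)
  E₂-adjacent {T} {S} T<N S<N (wrap-around last S/d≡0 S%d<) =
    e2-wrap (leaf-depth T) (parents-same-depth T S)
      (trans (cong suc (parent-pos T<N)) last)
      (trans (cong (pos ∘ digits h′) S/d≡0) (pos-digits h′ 0 (m^n>0 d h′)))
      (subst₂ _<_ (sym (digit-value S)) (sym (digit-value T)) S%d<)

  reduce-position : ∀ {x r Q} → r < d → Q < l → x ≡ r + Q * d → x % N ≡ r + Q * d
  reduce-position r<d Q<l refl = m<n⇒m%n≡m (position< r<d Q<l)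

  wrap-position : ∀ {x r} → r < d → x ≡ r + l * d → x % N ≡ r + 0 * d
  wrap-position {r = r} r<d refl = begin
    (r + l * d) % N   ≡⟨ cong (λ M → (r + M) % N) N≡l*d ⟨
    (r + N) % N       ≡⟨ [m+n]%n≡m%n r N ⟩
    r % N             ≡⟨ m<n⇒m%n≡m (<-≤-trans r<d d≤N) ⟩
    r                 ≡⟨ +-identityʳ r ⟨
    r + 0 * d         ∎
    where open ≡-Reasoning

  split-position : ∀ {S r Q} → r < d → S ≡ r + Q * d → S / d ≡ Q × S % d ≡ r
  split-position {r = r} {Q} r<d refl = block-div r Q r<d , block-mod r Q r<d

  shift-no-carry : ∀ T e → T + e ≡ (T % d + e) + T / d * d
  shift-no-carry T e = trans (cong (_+ e) (m≡m%n+[m/n]*n T d)) (regroup (T % d) (T / d) e d)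
    where
    regroup : ∀ n J e D → n + J * D + e ≡ (n + e) + J * D
    regroup = solve-∀

  shift-carry : ∀ T e → e < d → d ≤ T % d + e →
                T % d + e ∸ d < T % d × T + e ≡ (T % d + e ∸ d) + suc (T / d) * d
  shift-carry T e e<d d≤n+e = new-digit< , value
    where
    new-digit< : T % d + e ∸ d < T % d
    new-digit< = +-cancelʳ-< d _ (T % d) (subst (_< T % d + d) (sym (m∸n+n≡m d≤n+e)) (+-monoʳ-< (T % d) e<d))
    regroup : ∀ r D J → r + D + J * D ≡ r + (1 + J) * D
    regroup = solve-∀
    value : T + e ≡ (T % d + e ∸ d) + suc (T / d) * d
    value = trans (shift-no-carry T e)
              (trans (cong (_+ T / d * d) (sym (m∸n+n≡m d≤n+e))) (regroup (T % d + e ∸ d) d (T / d)))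

  E₂-pattern : ∀ {T} e → T < N → e < d → E₂Pattern T ((T + e) % N)
  E₂-pattern {T} e T<N e<d with T % d + e <? d
  ... | yes n+e<d = same-parent (proj₁ S-split) (subst (T % d ≤_) (sym (proj₂ S-split)) (m≤m+n (T % d) e))
    where
    S-split : (T + e) % N / d ≡ T / d × (T + e) % N % d ≡ T % d + e
    S-split = split-position n+e<d (reduce-position n+e<d (parent< T<N) (shift-no-carry T e))
  ... | no n+e≮d with shift-carry T e e<d (≮⇒≥ n+e≮d) | suc (T / d) <? l
  ...   | r<n , T+e≡ | yes J+1<l = next-parent (proj₁ S-split) (subst (_< T % d) (sym (proj₂ S-split)) r<n)
    where
    r<d : T % d + e ∸ d < d
    r<d = <-trans r<n (m%n<n T d)
    S-split : (T + e) % N / d ≡ suc (T / d) × (T + e) % N % d ≡ T % d + e ∸ d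
    S-split = split-position r<d (reduce-position r<d J+1<l T+e≡)
  ...   | r<n , T+e≡ | no J+1≮l = wrap-around last (proj₁ S-split) (subst (_< T % d) (sym (proj₂ S-split)) r<n)
    where
    r<d : T % d + e ∸ d < d
    r<d = <-trans r<n (m%n<n T d)
    last : suc (T / d) ≡ l
    last = ≤-antisym (parent< T<N) (≮⇒≥ J+1≮l)
    S-split : (T + e) % N / d ≡ 0 × (T + e) % N % d ≡ T % d + e ∸ d
    S-split = split-position r<d (wrap-position r<d (subst (λ Q → T + e ≡ T % d + e ∸ d + Q * d) last T+e≡))

  mod-+-small : ∀ a j → j < N → (a + j) % N ≡ (a % N + j) % N
  mod-+-small a j j<N = trans (%-distribˡ-+ a j N) (cong (λ z → (a % N + z) % N) (m<n⇒m%n≡m j<N))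

  leaf-edge : ∀ t e → e < d → leaf true t ~ leaf false (t + e)
  leaf-edge t e e<d = inj₁ (subst (λ S → Adj (leafAt true (t % N)) (leafAt false S)) (sym (mod-+-small t e (<-≤-trans e<d d≤N)))
                              (E₂-adjacent (m%n<n t N) (m%n<n _ N) (E₂-pattern e (m%n<n t N) e<d)))

  offset : ℕ → ℕ → ℕ
  offset x y = (y % N + N ∸ x % N) % N

  offset-mod : ∀ {x x′ y y′} → x % N ≡ x′ % N → y % N ≡ y′ % N → offset x y ≡ offset x′ y′
  offset-mod x≡ y≡ = cong₂ (λ a b → (b + N ∸ a) % N) x≡ y≡

  offset-+ : ∀ a j → j < N → offset a (a + j) ≡ j
  offset-+ a j j<N with a % N + j <? N
  ... | yes no-wrap = begin
    ((a + j) % N + N ∸ a % N) % N    ≡⟨ cong (λ z → (z + N ∸ a % N) % N) (trans (mod-+-small a j j<N) (m<n⇒m%n≡m no-wrap)) ⟩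
    (a % N + j + N ∸ a % N) % N      ≡⟨ cong (_% N) (trans (cong (_∸ a % N) (+-assoc (a % N) j N)) (m+n∸m≡n (a % N) (j + N))) ⟩
    (j + N) % N                      ≡⟨ [m+n]%n≡m%n j N ⟩
    j % N                            ≡⟨ m<n⇒m%n≡m j<N ⟩
    j                                ∎
    where open ≡-Reasoning
  ... | no wrap = begin
    ((a + j) % N + N ∸ a % N) % N    ≡⟨ cong (λ z → (z + N ∸ a % N) % N) (trans (mod-+-small a j j<N) (sym reduced)) ⟩
    ((a % N + j ∸ N) + N ∸ a % N) % N ≡⟨ cong (λ z → (z ∸ a % N) % N) (m∸n+n≡m N≤) ⟩
    (a % N + j ∸ a % N) % N          ≡⟨ cong (_% N) (m+n∸m≡n (a % N) j) ⟩
    j % N                            ≡⟨ m<n⇒m%n≡m j<N ⟩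
    j                                ∎
    where
    open ≡-Reasoning
    N≤ : N ≤ a % N + j
    N≤ = ≮⇒≥ wrap
    small : a % N + j ∸ N < N
    small = +-cancelʳ-< N _ N (subst (_< N + N) (sym (m∸n+n≡m N≤)) (+-mono-< (m%n<n a N) j<N))
    reduced : a % N + j ∸ N ≡ (a % N + j) % N
    reduced = trans (sym (m<n⇒m%n≡m small)) (m≤n⇒[n∸m]%m≡n%m N≤)

  back-forth : ∀ a e x → e ≤ N → (a + (N ∸ e) + (e + x)) % N ≡ (a + x) % N
  back-forth a e x e≤N = begin
    (a + (N ∸ e) + (e + x)) % N    ≡⟨ cong (_% N) (regroup a (N ∸ e) e x) ⟩
    (a + x + (N ∸ e + e)) % N      ≡⟨ cong (λ z → (a + x + z) % N) (m∸n+n≡m e≤N) ⟩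
    (a + x + N) % N                ≡⟨ [m+n]%n≡m%n (a + x) N ⟩
    (a + x) % N                    ∎
    where
    open ≡-Reasoning
    regroup : ∀ a y e x → a + y + (e + x) ≡ a + x + (y + e)
    regroup = solve-∀

  upper-neighbour : ∀ a e x → e ≤ N → e + x < d → leaf true (a + (N ∸ e)) ~ leaf false (a + x)
  upper-neighbour a e x e≤N e+x<d =
    subst (λ y → leaf true (a + (N ∸ e)) ~ y) (leaf-mod false (back-forth a e x e≤N)) (leaf-edge _ (e + x) e+x<d)

  -- The k-th digit of a path, or d if the path is shorter.
  digit-at : ℕ → List (Fin d) → ℕ
  digit-at _ [] = d
  digit-at zero (c ∷ _) = toℕ c
  digit-at (suc k) (_ ∷ p) = digit-at k p

  digit-at-++ : ∀ p c r → digit-at (length p) (p ++ c ∷ r) ≡ toℕ c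
  digit-at-++ [] c r = refl
  digit-at-++ (_ ∷ p) c r = digit-at-++ p c r

  module Avoiding (X : List V) (|X|<d : length X < d) where

    open Walks {V} {_~_} {X}
    open DecMembership _≟ᵛ_ using (_∈?_)

    label-free : (σ : V → ℕ) → ∃[ i ] i < d × (∀ z → σ z ≡ i → z ∉ X)
    label-free σ = free-label d σ X |X|<d

    walk-down : ∀ s q r {le le′} → (∀ r₁ r₂ {le₁} → r₁ ++ r₂ ≡ r → vtx s (q ++ r₁) le₁ ∉ X) →
                Walk (vtx s q le) (vtx s (q ++ r) le′)
    walk-down s q [] free = subst (Walk _) (vtx-cong (sym (++-identityʳ q))) here
    walk-down s q (c ∷ r) {le′ = le′} free =
      step (inj₁ tree) (free (c ∷ []) r {le₁} refl)
        (subst (Walk _) (vtx-cong (++-assoc q (c ∷ []) r)) (walk-down s (q ∷ʳ c) r {le′ = le″} free′))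
      where
      le″ : length ((q ∷ʳ c) ++ r) ≤ h
      le″ = subst (λ p → length p ≤ h) (sym (++-assoc q (c ∷ []) r)) le′
      le₁ : length (q ∷ʳ c) ≤ h
      le₁ = ≤-trans (subst (length (q ∷ʳ c) ≤_) (sym (length-++ (q ∷ʳ c))) (m≤m+n _ (length r))) le″
      free′ : ∀ r₁ r₂ {le₁} → r₁ ++ r₂ ≡ r → vtx s ((q ∷ʳ c) ++ r₁) le₁ ∉ X
      free′ r₁ r₂ {le₁} eq =
        subst (_∉ X) (vtx-cong (sym (++-assoc q (c ∷ []) r₁)))
          (free (c ∷ r₁) r₂ {subst (λ p → length p ≤ h) (++-assoc q (c ∷ []) r₁) le₁} (cong (c ∷_) eq))

    -- (1) A free vertex descends to a leaf of its tree: below depth |p| use a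
    -- child index that no vertex of X has at that depth, then leftmost children.
    descend : ∀ s p le → vtx s p le ∉ X → ∃[ t ] Walk (vtx s p le) (leaf s t)
    descend s p le p-free with length p <? h
    ... | no |p|≮h = pos p , subst (Walk _) (leaf-pos s p le (≤-antisym le (≮⇒≥ |p|≮h))) here
    ... | yes |p|<h with label-free (digit-at (length p) ∘ Vtx.path)
    ... | i , i<d , i-free =
          pos P , subst (Walk _) (leaf-pos s P _ |P|≡h) (walk-down s p (c ∷ zs) {le′ = ≤-reflexive |P|≡h} free)
      where
      c : Fin d
      c = fromℕ< i<d
      zs : List (Fin d)
      zs = replicate (h ∸ suc (length p)) fzero
      P : List (Fin d)
      P = p ++ c ∷ zs
      |P|≡h : length P ≡ h
      |P|≡h = trans (length-++ p)
                (trans (cong (λ n → length p + suc n) (length-replicate (h ∸ suc (length p))))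
                       (trans (+-suc (length p) _) (m+[n∸m]≡n |p|<h)))
      free : ∀ r₁ r₂ {le₁} → r₁ ++ r₂ ≡ c ∷ zs → vtx s (p ++ r₁) le₁ ∉ X
      free [] _ _ = subst (_∉ X) (vtx-cong (sym (++-identityʳ p))) p-free
      free (c′ ∷ r₁) _ eq = i-free _
        (trans (digit-at-++ p c′ r₁) (trans (cong toℕ (proj₁ (∷-injective eq))) (toℕ-fromℕ< i<d)))

    -- (2) Every upper leaf t has a free lower neighbour t + e: label vertices by
    -- their offset from t.
    lower-neighbour : ∀ t → ∃[ e ] e < d × leaf false (t + e) ∉ X
    lower-neighbour t with label-free (λ z → offset t (pos (Vtx.path z)))
    ... | e , e<d , e-free = e , e<d , e-free _
          (trans (offset-mod refl (trans (cong (_% N) (pos-leaf false (t + e))) (m%n%n≡m%n _ N)))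
                 (offset-+ t e (<-≤-trans e<d d≤N)))

    reach-lower : ∀ x → x ∉ X → ∃[ a ] Walk x (leaf false a)
    reach-lower (vtx false p le) x-free = descend false p le x-free
    reach-lower (vtx true p le) x-free with descend true p le x-free
    ... | t , w with lower-neighbour t
    ... | e , e<d , e-free = t + e , w ++ʷ edge-walk (leaf-edge t e e<d) e-free

    inner : V → Set
    inner z = length (Vtx.path z) < h

    via-lower-root : (∀ z → Vtx.upper z ≡ false → inner z → z ∉ X) →
                     ∀ a b → leaf false a ∉ X → leaf false b ∉ X → Walk (leaf false a) (leaf false b)
    via-lower-root inner-free a b a-free b-free =
      reverse ~-sym (inner-free root refl z<s) (from-root a a-free) ++ʷ from-root b b-free
      where
      root : V
      root = vtx false [] z≤n
      from-root : ∀ c → leaf false c ∉ X → Walk root (leaf false c)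
      from-root c c-free = walk-down false [] (digits h (c % N)) free
        where
        P : List (Fin d)
        P = digits h (c % N)
        free : ∀ r₁ r₂ {le₁} → r₁ ++ r₂ ≡ P → vtx false r₁ le₁ ∉ X
        free r₁ [] eq = subst (_∉ X) (vtx-cong (sym (trans (sym (++-identityʳ r₁)) eq))) c-free
        free r₁ (x ∷ r₂) eq = inner-free _ refl (begin-strict
          length r₁                    <⟨ m<m+n (length r₁) {suc (length r₂)} z<s ⟩
          length r₁ + length (x ∷ r₂)  ≡⟨ length-++ r₁ ⟨
          length (r₁ ++ x ∷ r₂)        ≡⟨ cong length eq ⟩
          length P                     ≡⟨ length-digits h (c % N) ⟩
          h                            ∎)
          where open ≤-Reasoning

    lower-label : ℕ → List (Fin d) → ℕ
    lower-label a p with length p ≟ h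
    ... | yes _ = offset a (pos p) ∸ 1
    ... | no _ = d′

    bridge-label : ℕ → ℕ → V → ℕ
    bridge-label a k′ (vtx true p _) = k′ + offset (pos p) a
    bridge-label a k′ (vtx false p _) = lower-label a p

    -- A label i missed by X is not below k′; if i < d - 1, the upper leaf i - k' positions before a is free
    -- and adjacent to both ends; if i = d - 1, the lower tree's interior is free.
    bridge : ∀ a k′ → suc k′ < N → (∀ (j : Fin k′) → leaf false (a + suc (toℕ j)) ∈ X) →
             leaf false a ∉ X → leaf false (a + suc k′) ∉ X → Walk (leaf false a) (leaf false (a + suc k′))
    bridge a k′ k<N between a-free b-free with label-free (bridge-label a k′)
    ... | i , i<d , i-free with i <? k′
    ...   | yes i<k′ = ⊥-elim (i-free _ lower-leaf-label
                         (subst (λ j → leaf false (a + suc j) ∈ X) (toℕ-fromℕ< i<k′) (between (fromℕ< i<k′))))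
      where
      lower-leaf-label : lower-label a (digits h ((a + suc i) % N)) ≡ i
      lower-leaf-label with length (digits h ((a + suc i) % N)) ≟ h
      ... | no ≢h = ⊥-elim (≢h (length-digits h ((a + suc i) % N)))
      ... | yes _ = cong (_∸ 1) (trans (offset-mod refl (trans (cong (_% N) (pos-leaf false (a + suc i))) (m%n%n≡m%n _ N)))
                                       (offset-+ a (suc i) (<-trans (s≤s i<k′) k<N)))
    ...   | no i≮k′ with i <? d′
    ...     | yes i<d′ = step (~-sym edge-a) w-free (edge-walk edge-b b-free)
      where
      e : ℕ
      e = i ∸ k′
      k′≤i : k′ ≤ i
      k′≤i = ≮⇒≥ i≮k′
      e≤N : e ≤ N
      e≤N = ≤-trans (m∸n≤m i k′) (<⇒≤ (<-≤-trans i<d d≤N))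
      w : ℕ
      w = a + (N ∸ e)
      edge-a : leaf true w ~ leaf false a
      edge-a = subst (λ y → leaf true w ~ leaf false y) (+-identityʳ a)
                 (upper-neighbour a e 0 e≤N (subst (_< d) (sym (+-identityʳ e)) (≤-<-trans (m∸n≤m i k′) i<d)))
      edge-b : leaf true w ~ leaf false (a + suc k′)
      edge-b = upper-neighbour a e (suc k′) e≤N (subst (_< d) (sym e+k≡i+1) (s≤s i<d′))
        where
        e+k≡i+1 : e + suc k′ ≡ suc i
        e+k≡i+1 = trans (+-suc e k′) (cong suc (m∸n+n≡m k′≤i))
      w-free : leaf true w ∉ X
      w-free = i-free _ (trans (cong (k′ +_) label) (m+[n∸m]≡n k′≤i))
        where
        w+e≡a : (w + e) % N ≡ a % N
        w+e≡a = trans (cong (λ z → (w + z) % N) (sym (+-identityʳ e)))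
                      (trans (back-forth a e 0 e≤N) (cong (_% N) (+-identityʳ a)))
        label : offset (pos (digits h (w % N))) a ≡ e
        label = trans (offset-mod (trans (cong (_% N) (pos-leaf true w)) (m%n%n≡m%n w N)) (sym w+e≡a))
                      (offset-+ w e (≤-<-trans (m∸n≤m i k′) (<-≤-trans i<d d≤N)))
    ...     | no i≮d′ = via-lower-root inner-free a (a + suc k′) a-free b-free
      where
      i≡d′ : i ≡ d′
      i≡d′ = ≤-antisym (≤-pred i<d) (≮⇒≥ i≮d′)
      inner-free : ∀ z → Vtx.upper z ≡ false → inner z → z ∉ X
      inner-free (vtx false p _) refl |p|<h = i-free _ (trans inner-label (sym i≡d′))
        where
        inner-label : lower-label a p ≡ d′
        inner-label with length p ≟ h
        ... | yes |p|≡h = ⊥-elim (<⇒≢ |p|<h |p|≡h)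
        ... | no _ = refl

    lower-path : ∀ k → Acc _<_ k → ∀ a → k < N → leaf false a ∉ X → leaf false (a + k) ∉ X →
                 Walk (leaf false a) (leaf false (a + k))
    lower-path zero _ a _ _ _ = subst (Walk _) (cong (leaf false) (sym (+-identityʳ a))) here
    lower-path (suc k′) (acc smaller) a k<N a-free b-free
      with all? (λ (j : Fin k′) → leaf false (a + suc (toℕ j)) ∈? X)
    ... | yes between = bridge a k′ k<N between a-free b-free
    ... | no ¬between with ¬∀⟶∃¬ k′ _ (λ j → leaf false (a + suc (toℕ j)) ∈? X) ¬between
    ... | j , m-free =
          lower-path (suc (toℕ j)) (smaller (s≤s (toℕ<n j))) a (<-trans (s≤s (toℕ<n j)) k<N) a-free m-free
          ++ʷ subst (Walk _) (cong (leaf false) rest≡)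
                (lower-path (k′ ∸ toℕ j) (smaller (s≤s (m∸n≤m k′ (toℕ j)))) (a + suc (toℕ j))
                   (≤-<-trans (m∸n≤m k′ (toℕ j)) (<-trans (n<1+n k′) k<N)) m-free
                   (subst (_∉ X) (cong (leaf false) (sym rest≡)) b-free))
      where
      rest≡ : a + suc (toℕ j) + (k′ ∸ toℕ j) ≡ a + suc k′
      rest≡ = trans (+-assoc a (suc (toℕ j)) (k′ ∸ toℕ j)) (cong (λ n → a + suc n) (m+[n∸m]≡n (<⇒≤ (toℕ<n j))))

    ordered-leaves-joined : ∀ a b → a % N ≤ b % N → leaf false a ∉ X → leaf false b ∉ X →
                            Walk (leaf false a) (leaf false b)
    ordered-leaves-joined a b a≤b a-free b-free =
      subst₂ Walk (sym (reduce a)) (trans (cong (leaf false) (m+[n∸m]≡n a≤b)) (sym (reduce b)))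
        (lower-path (b % N ∸ a % N) (<-wellFounded _) (a % N) (≤-<-trans (m∸n≤m (b % N) (a % N)) (m%n<n b N))
           (subst (_∉ X) (reduce a) a-free)
           (subst (_∉ X) (trans (reduce b) (cong (leaf false) (sym (m+[n∸m]≡n a≤b)))) b-free))
      where
      reduce : ∀ c → leaf false c ≡ leaf false (c % N)
      reduce c = leaf-mod false (sym (m%n%n≡m%n c N))

    lower-leaves-joined : ∀ a b → leaf false a ∉ X → leaf false b ∉ X → Walk (leaf false a) (leaf false b)
    lower-leaves-joined a b a-free b-free with a % N ≤? b % N
    ... | yes a≤b = ordered-leaves-joined a b a≤b a-free b-free
    ... | no a≰b = reverse ~-sym b-free (ordered-leaves-joined b a (<⇒≤ (≰⇒> a≰b)) b-free a-free)

    connected : ConnectedAvoiding _~_ X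
    connected x y x-free y-free with reach-lower x x-free | reach-lower y y-free
    ... | a , x→a | b , y→b =
          x→a ++ʷ (lower-leaves-joined a b (end-free x-free x→a) (end-free y-free y→b) ++ʷ reverse ~-sym y-free y→b)

  child : Fin d → V
  child c = vtx true (c ∷ []) (s≤s z≤n)

  root-and-children : List V
  root-and-children = vtx true [] z≤n ∷ map child (allFin d)

  root-and-children-unique : Unique root-and-children
  root-and-children-unique = root-not-child (allFin d) ∷ Unique.map⁺ child-injective (Unique.allFin⁺ d)
    where
    root-not-child : ∀ cs → All (λ z → ¬ vtx true [] z≤n ≡ z) (map child cs)
    root-not-child [] = []
    root-not-child (_ ∷ cs) = (λ ()) ∷ root-not-child cs
    child-injective : ∀ {c c′} → child c ≡ child c′ → c ≡ c′
    child-injective refl = refl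

  d<|root-and-children| : d < length root-and-children
  d<|root-and-children| = s≤s (≤-reflexive (sym (trans (length-map child (allFin d)) (length-tabulate (λ c → c)))))

lemma6 : ∀ (d h : ℕ) → 1 ≤ d → 1 ≤ h → KConnected (DTEdge d h) d
lemma6 (suc d′) (suc h′) _ _ =
  (root-and-children , root-and-children-unique , d<|root-and-children|) ,
  λ X |X|<d → Avoiding.connected X |X|<d
  where open DoubleTree d′ h′
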